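{- Let $(\Delta,\gamma)$ be a voltage graph with $\gamma:E_\Delta\to G$, let $\Gamma=\Delta\times_\gamma G$ with canonical covering $\phi:\Gamma\to\Delta$, $(x,g)\mapsto x$, and assume $\Gamma$ is connected. Fix a vertex $v_0$ of $\Gamma$ and put $v_\Delta=\phi(v_0)$. Let $\Delta_\top$ be a connected graph with a covering $\mu:\Delta_\top\to\Delta$ and let $v_\top$ be a vertex of $\Delta_\top$ with $\mu(v_\top)=v_\Delta$. Define $\nu$ as follows: for a vertex $v$ of $\Gamma$, choose a walk $p$ in $\Gamma$ from $v_0$ to $v$ and let $\nu(v)$ be the terminal vertex of the unique walk in $\Delta_\top$ starting at $v_\top$ that lifts $\phi(p)$ via $\mu$; for an edge $e$ of $\Gamma$, let $\nu(e)$ be the unique edge of $\Delta_\top$ with $\mu(\nu(e))=\phi(e)$ whose initial vertex is $\nu(\iota(e))$. Then this rule is independent of the choices of walks and defines a covering $\nu:\Gamma\to\Delta_\top$ (necessarily with $\phi=\mu\circ\nu$) if and only if $\Delta_\top$ is a good cover of $(\Delta,\gamma)$.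
   Context: Graphs are directed multigraphs $\Gamma=(V_\Gamma,E_\Gamma,\iota,\tau)$ with $\iota,\tau:E_\Gamma\to V_\Gamma$ the initial and terminal endpoint maps; loops and parallel edges are allowed. A homomorphism $\varphi:\Gamma\to\Delta$ is a pair of maps $V_\Gamma\to V_\Delta$, $E_\Gamma\to E_\Delta$ (both written $\varphi$) with $\iota(\varphi(e))=\varphi(\iota(e))$, $\tau(\varphi(e))=\varphi(\tau(e))$. For a vertex $v$, $\mathrm{In}(v)=\{e:\tau(e)=v\}$, $\mathrm{Out}(v)=\{e:\iota(e)=v\}$. A walk is a sequence $v_0,e_1,v_1,\dots,e_n,v_n$ with $\{v_{i-1},v_i\}=\{\iota(e_i),\tau(e_i)\}$; it is cyclic if $v_n=v_0$; a graph is connected if any two vertices are joined by a walk. A covering $\mu:\Delta'\to\Delta$ is a surjective homomorphism such that for every vertex $v$ of $\Delta'$, $\mu$ maps $\mathrm{In}(v)$ bijectively onto $\mathrm{In}(\mu(v))$ and $\mathrm{Out}(v)$ bijectively onto $\mathrm{Out}(\mu(v))$. A lift of a walk $p$ of $\Delta$ via $\mu$ is a walk $q$ of $\Delta'$ with $\mu(q)=p$; for each vertex $u$ of $\Delta'$ and walk $p$ starting at $\mu(u)$ there is exactly one lift of $p$ starting at $u$. For a voltage assignment $\gamma:E_\Delta\to G$, the derived graph $\Delta\times_\gamma G$ has vertex set $V_\Delta\times G$, edge set $E_\Delta\times G$, $\iota(e,h)=(\iota(e),h)$, $\tau(e,h)=(\tau(e),h\gamma(e))$. For a walk $p$, $\gamma(p)=\gamma(e_1)^{\varepsilon_1}\cdots\gamma(e_n)^{\varepsilon_n}$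 with $\varepsilon_i=1$ if $v_{i-1}=\iota(e_i)$, $v_i=\tau(e_i)$ and $\varepsilon_i=-1$ otherwise. A covering $\mu:\Delta_\top\to\Delta$ is good (and $\Delta_\top$ is a good cover of $(\Delta,\gamma)$) if for every cyclic walk $p$ in $\Delta$ with $\gamma(p)=1_G$, every lift of $p$ via $\mu$ is a cyclic walk in $\Delta_\top$. -}

module Defs where

open import Data.Product using (Σ; ∃; _×_; _,_; proj₁)
open import Data.List using (List; []; _∷_; map; foldr)
open import Relation.Binary.PropositionalEquality using (_≡_)
open import Algebra.Core using (Op₁; Op₂)

record Graph : Set₁ where
  field
    V : Set
    E : Set
    ι : E → V
    τ : E → V
open Graph public

record Hom (Γ Δ : Graph) : Set where
  field
    vmap : V Γ → V Δ
    emap : E Γ → E Δ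
    ι-comm : ∀ e → ι Δ (emap e) ≡ vmap (ι Γ e)
    τ-comm : ∀ e → τ Δ (emap e) ≡ vmap (τ Γ e)
open Hom public

-- Surjective homomorphism which maps In(v) bijectively onto In(μ v)
-- and Out(v) bijectively onto Out(μ v) (bijectivity written out as
-- injectivity + surjectivity on these edge sets).
record IsCovering {Γ Δ : Graph} (μ : Hom Γ Δ) : Set where
  field
    vsurj : ∀ (y : V Δ) → ∃ λ (x : V Γ) → vmap μ x ≡ y
    esurj : ∀ (f : E Δ) → ∃ λ (e : E Γ) → emap μ e ≡ f
    in-inj : ∀ (v : V Γ) (e e' : E Γ) → τ Γ e ≡ v → τ Γ e' ≡ v →
             emap μ e ≡ emap μ e' → e ≡ e'
    in-surj : ∀ (v : V Γ) (f : E Δ) → τ Δ f ≡ vmap μ v →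
              ∃ λ (e : E Γ) → τ Γ e ≡ v × emap μ e ≡ f
    out-inj : ∀ (v : V Γ) (e e' : E Γ) → ι Γ e ≡ v → ι Γ e' ≡ v →
              emap μ e ≡ emap μ e' → e ≡ e'
    out-surj : ∀ (v : V Γ) (f : E Δ) → ι Δ f ≡ vmap μ v →
               ∃ λ (e : E Γ) → ι Γ e ≡ v × emap μ e ≡ f

-- A step of a walk: an edge traversed forwards (ε = 1) or backwards (ε = -1).
data Dir : Set where
  fwd bwd : Dir

Step : Graph → Set
Step Γ = E Γ × Dir

src : (Γ : Graph) → Step Γ → V Γ
src Γ (e , fwd) = ι Γ e
src Γ (e , bwd) = τ Γ e

tgt : (Γ : Graph) → Step Γ → V Γ
tgt Γ (e , fwd) = τ Γ e
tgt Γ (e , bwd) = ι Γ e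

IsWalk : (Γ : Graph) → V Γ → List (Step Γ) → V Γ → Set
IsWalk Γ v [] w = v ≡ w
IsWalk Γ v (s ∷ ss) w = src Γ s ≡ v × IsWalk Γ (tgt Γ s) ss w

record Walk (Γ : Graph) : Set where
  field
    start : V Γ
    steps : List (Step Γ)
    end   : V Γ
    valid : IsWalk Γ start steps end
open Walk public

Cyclic : {Γ : Graph} → Walk Γ → Set
Cyclic p = end p ≡ start p

Connected : Graph → Set
Connected Γ = ∀ (a b : V Γ) → Σ (Walk Γ) λ p → start p ≡ a × end p ≡ b

mapStep : {Γ Δ : Graph} → Hom Γ Δ → Step Γ → Step Δ
mapStep h (e , d) = (emap h e , d)

IsLiftOf : {Γ Δ : Graph} → Hom Γ Δ → Walk Γ → V Δ → List (Step Δ) → Set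
IsLiftOf μ q x ss = vmap μ (start q) ≡ x × map (mapStep μ) (steps q) ≡ ss

voltage : {G : Set} (_∙_ : Op₂ G) (ε : G) (_⁻¹ : Op₁ G) {Δ : Graph} →
          (E Δ → G) → List (Step Δ) → G
voltage _∙_ ε _⁻¹ {Δ} γ [] = ε
voltage _∙_ ε _⁻¹ {Δ} γ ((e , fwd) ∷ ss) = γ e ∙ voltage _∙_ ε _⁻¹ {Δ} γ ss
voltage _∙_ ε _⁻¹ {Δ} γ ((e , bwd) ∷ ss) = (γ e ⁻¹) ∙ voltage _∙_ ε _⁻¹ {Δ} γ ss

Derived : (Δ : Graph) {G : Set} (_∙_ : Op₂ G) → (E Δ → G) → Graph
Derived Δ {G} _∙_ γ = record
  { V = V Δ × G
  ; E = E Δ × G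
  ; ι = λ { (e , h) → (ι Δ e , h) }
  ; τ = λ { (e , h) → (τ Δ e , h ∙ γ e) }
  }

canon : (Δ : Graph) {G : Set} (_∙_ : Op₂ G) (γ : E Δ → G) → Hom (Derived Δ _∙_ γ) Δ
canon Δ _∙_ γ = record
  { vmap = proj₁
  ; emap = proj₁
  ; ι-comm = λ _ → Relation.Binary.PropositionalEquality.refl
  ; τ-comm = λ _ → Relation.Binary.PropositionalEquality.refl
  }

-- μ : Δtop → Δ is a good covering of (Δ, γ) (covering property assumed separately):
-- every lift of a cyclic walk with trivial voltage is cyclic.
IsGood : {G : Set} (_∙_ : Op₂ G) (ε : G) (_⁻¹ : Op₁ G) {Δ Δtop : Graph} →
         (E Δ → G) → Hom Δtop Δ → Set
IsGood _∙_ ε _⁻¹ {Δ} {Δtop} γ μ =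
  ∀ (p : Walk Δ) → Cyclic p → voltage _∙_ ε _⁻¹ {Δ} γ (steps p) ≡ ε →
  ∀ (q : Walk Δtop) → IsLiftOf μ q (start p) (steps p) → Cyclic q

-- ν : Γ → Δtop is given by the rule of the statement:
-- for every walk p of Γ from v₀ and the lift q of φ(p) via μ starting at vtop,
-- ν(end p) = end q; and for every edge e, ν(e) lies over φ(e) and starts at ν(ι e).
FollowsRule : {Γ Δ Δtop : Graph} (φ : Hom Γ Δ) (μ : Hom Δtop Δ) →
              V Γ → V Δtop → Hom Γ Δtop → Set
FollowsRule {Γ} {Δ} {Δtop} φ μ v₀ vtop ν =
  (∀ (p : Walk Γ) → start p ≡ v₀ →
   ∀ (q : Walk Δtop) → start q ≡ vtop →
   IsLiftOf μ q (vmap φ (start p)) (map (mapStep φ) (steps p)) →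
   vmap ν (end p) ≡ end q)
  × (∀ (e : E Γ) → emap μ (emap ν e) ≡ emap φ e × ι Δtop (emap ν e) ≡ vmap ν (ι Γ e))

{-# OPTIONS --safe #-}
-- A walk of Γ from (x , g) to (y , h)
-- projects to a walk of Δ of voltage g⁻¹h, so φ is itself good, and the φ-images of two walks
-- of Γ with the same ends differ by a cyclic walk of trivial voltage. If μ is good, the lift of
-- such a cyclic walk via μ is cyclic, so by uniqueness of lifts ν is well defined; it is a
-- homomorphism with μ ∘ ν = φ, and a vertex-surjective homomorphism over Δ between two
-- coverings of Δ is a covering.
-- Conversely, given ν, a lift of a cyclic walk p of trivial voltage via μ starts at some ν(w);
-- the lift of p via φ from w is cyclic, and its image under ν lifts p via μ from the same
-- vertex, so uniqueness of lifts makes the given lift cyclic too.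
module Submission where

open import Defs
open import Data.Product using (Σ; ∃; _×_; _,_; proj₁; proj₂)
open import Data.List using (List; []; _∷_; map; _++_)
open import Data.List.Properties using (map-++; map-∘; map-cong; ∷-injective)
open import Relation.Binary.PropositionalEquality
open import Algebra.Core using (Op₁; Op₂)
open import Algebra.Bundles using (Group)
open import Algebra.Structures using (IsGroup)
open import Function.Base using (_∘_)
open import Function.Bundles using (_⇔_; mk⇔)
import Algebra.Properties.Group as GroupProperties

module _ (Γ : Graph) where

  flipStep : Step Γ → Step Γ
  flipStep (e , fwd) = e , bwd
  flipStep (e , bwd) = e , fwd

  reverseWalk : List (Step Γ) → List (Step Γ)
  reverseWalk [] = []
  reverseWalk (s ∷ ss) = reverseWalk ss ++ flipStep s ∷ []

  IsWalk-++ : ∀ {a b c} ss ts → IsWalk Γ a ss b → IsWalk Γ b ts c → IsWalk Γ a (ss ++ ts) c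
  IsWalk-++ []       ts refl     wt = wt
  IsWalk-++ (s ∷ ss) ts (p , ws) wt = p , IsWalk-++ ss ts ws wt

  IsWalk-flipStep : ∀ s → IsWalk Γ (tgt Γ s) (flipStep s ∷ []) (src Γ s)
  IsWalk-flipStep (e , fwd) = refl , refl
  IsWalk-flipStep (e , bwd) = refl , refl

  IsWalk-reverse : ∀ {a b} ss → IsWalk Γ a ss b → IsWalk Γ b (reverseWalk ss) a
  IsWalk-reverse []       refl        = refl
  IsWalk-reverse (s ∷ ss) (refl , ws) =
    IsWalk-++ (reverseWalk ss) (flipStep s ∷ []) (IsWalk-reverse ss ws) (IsWalk-flipStep s)

  IsWalk-end-unique : ∀ {a b c} ss → IsWalk Γ a ss b → IsWalk Γ a ss c → b ≡ c
  IsWalk-end-unique []       refl     refl     = refl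
  IsWalk-end-unique (s ∷ ss) (_ , ws) (_ , wt) = IsWalk-end-unique ss ws wt

  walkBetween : Connected Γ → ∀ a b → ∃ λ ss → IsWalk Γ a ss b
  walkBetween conn a b with conn a b
  ... | p , refl , refl = steps p , valid p

_∘ʰ_ : {Γ Δ Θ : Graph} → Hom Δ Θ → Hom Γ Δ → Hom Γ Θ
h ∘ʰ k = record
  { vmap   = vmap h ∘ vmap k
  ; emap   = emap h ∘ emap k
  ; ι-comm = λ e → trans (ι-comm h (emap k e)) (cong (vmap h) (ι-comm k e))
  ; τ-comm = λ e → trans (τ-comm h (emap k e)) (cong (vmap h) (τ-comm k e))
  }

_≗ʰ_ : {Γ Δ : Graph} → Hom Γ Δ → Hom Γ Δ → Set
h ≗ʰ k = (vmap h ≗ vmap k) × (emap h ≗ emap k)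

module _ {Γ Δ : Graph} (h : Hom Γ Δ) where

  IsWalk-map : ∀ {a b} ss → IsWalk Γ a ss b →
               IsWalk Δ (vmap h a) (map (mapStep h) ss) (vmap h b)
  IsWalk-map []               refl        = refl
  IsWalk-map {b = b} ((e , fwd) ∷ ss) (refl , ws) =
    ι-comm h e , subst (λ x → IsWalk Δ x (map (mapStep h) ss) (vmap h b))
                       (sym (τ-comm h e)) (IsWalk-map ss ws)
  IsWalk-map {b = b} ((e , bwd) ∷ ss) (refl , ws) =
    τ-comm h e , subst (λ x → IsWalk Δ x (map (mapStep h) ss) (vmap h b))
                       (sym (ι-comm h e)) (IsWalk-map ss ws)

  map-reverseWalk : ∀ ss →
                    map (mapStep h) (reverseWalk Γ ss) ≡ reverseWalk Δ (map (mapStep h) ss)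
  map-reverseWalk []       = refl
  map-reverseWalk (s ∷ ss) =
    trans (map-++ (mapStep h) (reverseWalk Γ ss) (flipStep Γ s ∷ []))
          (cong₂ _++_ (map-reverseWalk ss) (cong (_∷ []) (mapStep-flipStep s)))
    where
    mapStep-flipStep : ∀ s → mapStep h (flipStep Γ s) ≡ flipStep Δ (mapStep h s)
    mapStep-flipStep (e , fwd) = refl
    mapStep-flipStep (e , bwd) = refl

  image-end : ∀ {a b x y} qs ss → IsWalk Γ a qs b → vmap h a ≡ x →
              map (mapStep h) qs ≡ ss → IsWalk Δ x ss y → vmap h b ≡ y
  image-end qs _ wq refl refl ws = IsWalk-end-unique Δ _ (IsWalk-map qs wq) ws

module _ {Γ Δ : Graph} (h k : Hom Γ Δ) (emap-agree : emap h ≗ emap k) where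

  vmap-agree-tgt : ∀ s → vmap h (tgt Γ s) ≡ vmap k (tgt Γ s)
  vmap-agree-tgt (e , fwd) =
    trans (sym (τ-comm h e)) (trans (cong (τ Δ) (emap-agree e)) (τ-comm k e))
  vmap-agree-tgt (e , bwd) =
    trans (sym (ι-comm h e)) (trans (cong (ι Δ) (emap-agree e)) (ι-comm k e))

  vmap-agree-along : ∀ {a b} ss → IsWalk Γ a ss b → vmap h a ≡ vmap k a → vmap h b ≡ vmap k b
  vmap-agree-along []       refl     eq = eq
  vmap-agree-along (s ∷ ss) (_ , ws) _  = vmap-agree-along ss ws (vmap-agree-tgt s)

  vmap-agree : Connected Γ → ∀ a → vmap h a ≡ vmap k a → vmap h ≗ vmap k
  vmap-agree conn a eq b = let ss , ws = walkBetween Γ conn a b in vmap-agree-along ss ws eq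

record Lift {Γ Δ : Graph} (μ : Hom Γ Δ) (u : V Γ) (ss : List (Step Δ)) : Set where
  field
    trail  : List (Step Γ)
    finish : V Γ
    isWalk : IsWalk Γ u trail finish
    over   : map (mapStep μ) trail ≡ ss
open Lift

module _ {Γ Δ : Graph} {μ : Hom Γ Δ} (cov : IsCovering μ) where
  open IsCovering cov

  private
    consLift : ∀ {u t ss} s → src Γ s ≡ u → mapStep μ s ≡ t →
               Lift μ (tgt Γ s) ss → Lift μ u (t ∷ ss)
    consLift s p q l = record
      { trail  = s ∷ trail l
      ; finish = finish l
      ; isWalk = p , isWalk l
      ; over   = cong₂ _∷_ q (over l)
      }

  lift : ∀ {u x y} ss → IsWalk Δ x ss y → vmap μ u ≡ x → Lift μ u ss
  lift {u} []     _ _ = record { trail = [] ; finish = u ; isWalk = refl ; over = refl }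
  lift {u} ((f , fwd) ∷ ss) (ιf , ws) μu with out-surj u f (trans ιf (sym μu))
  ... | e , ιe , μe = consLift (e , fwd) ιe (cong (_, fwd) μe)
                        (lift ss ws (trans (sym (τ-comm μ e)) (cong (τ Δ) μe)))
  lift {u} ((f , bwd) ∷ ss) (τf , ws) μu with in-surj u f (trans τf (sym μu))
  ... | e , τe , μe = consLift (e , bwd) τe (cong (_, bwd) μe)
                        (lift ss ws (trans (sym (ι-comm μ e)) (cong (ι Δ) μe)))

  lift-end-unique : ∀ {u u′ w w′} qs rs → IsWalk Γ u qs w → IsWalk Γ u′ rs w′ →
                    u ≡ u′ → map (mapStep μ) qs ≡ map (mapStep μ) rs → w ≡ w′
  lift-end-unique [] [] refl refl eq _ = eq
  lift-end-unique ((e , fwd) ∷ qs) ((e′ , fwd) ∷ rs) (ιe , wq) (ιe′ , wr) refl eq =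
    let hd , tl = ∷-injective eq
    in lift-end-unique qs rs wq wr (cong (τ Γ) (out-inj _ e e′ ιe ιe′ (cong proj₁ hd))) tl
  lift-end-unique ((e , bwd) ∷ qs) ((e′ , bwd) ∷ rs) (τe , wq) (τe′ , wr) refl eq =
    let hd , tl = ∷-injective eq
    in lift-end-unique qs rs wq wr (cong (ι Γ) (in-inj _ e e′ τe τe′ (cong proj₁ hd))) tl
  lift-end-unique ((_ , fwd) ∷ _) ((_ , bwd) ∷ _) _ _ _ ()
  lift-end-unique ((_ , bwd) ∷ _) ((_ , fwd) ∷ _) _ _ _ ()

  lift-start-unique : ∀ {u u′ w w′} qs rs → IsWalk Γ u qs w → IsWalk Γ u′ rs w′ →
                      w ≡ w′ → map (mapStep μ) qs ≡ map (mapStep μ) rs → u ≡ u′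
  lift-start-unique qs rs wq wr eq same =
    lift-end-unique (reverseWalk Γ qs) (reverseWalk Γ rs)
      (IsWalk-reverse Γ qs wq) (IsWalk-reverse Γ rs wr) eq
      (trans (map-reverseWalk μ qs)
        (trans (cong (reverseWalk Δ) same) (sym (map-reverseWalk μ rs))))

isCovering-factor : {Γ Δ Δ′ : Graph} {μ : Hom Δ′ Δ} {φ : Hom Γ Δ} {ν : Hom Γ Δ′} →
                    IsCovering μ → IsCovering φ → (∀ y → ∃ λ x → vmap ν x ≡ y) →
                    (μ ∘ʰ ν) ≗ʰ φ → IsCovering ν
isCovering-factor {Γ} {Δ} {Δ′} {μ} {φ} {ν} μ-cov φ-cov ν-vsurj (μν-v , μν-e) = record
  { vsurj    = ν-vsurj
  ; esurj    = esurj
  ; in-inj   = λ v e e′ τe τe′ νe → φ.in-inj v e e′ τe τe′ (φ-agree νe)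
  ; in-surj  = in-surj
  ; out-inj  = λ v e e′ ιe ιe′ νe → φ.out-inj v e e′ ιe ιe′ (φ-agree νe)
  ; out-surj = out-surj
  }
  where
  module μ = IsCovering μ-cov
  module φ = IsCovering φ-cov

  φ-agree : ∀ {e e′} → emap ν e ≡ emap ν e′ → emap φ e ≡ emap φ e′
  φ-agree {e} {e′} νe = trans (sym (μν-e e)) (trans (cong (emap μ) νe) (μν-e e′))

  out-surj : ∀ v f → ι Δ′ f ≡ vmap ν v → ∃ λ e → ι Γ e ≡ v × emap ν e ≡ f
  out-surj v f ιf =
    let e , ιe , φe = φ.out-surj v (emap μ f)
                        (trans (ι-comm μ f) (trans (cong (vmap μ) ιf) (μν-v v)))
    in e , ιe , μ.out-inj (vmap ν v) (emap ν e) f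
                  (trans (ι-comm ν e) (cong (vmap ν) ιe)) ιf (trans (μν-e e) φe)

  in-surj : ∀ v f → τ Δ′ f ≡ vmap ν v → ∃ λ e → τ Γ e ≡ v × emap ν e ≡ f
  in-surj v f τf =
    let e , τe , φe = φ.in-surj v (emap μ f)
                        (trans (τ-comm μ f) (trans (cong (vmap μ) τf) (μν-v v)))
    in e , τe , μ.in-inj (vmap ν v) (emap ν e) f
                  (trans (τ-comm ν e) (cong (vmap ν) τe)) τf (trans (μν-e e) φe)

  esurj : ∀ f → ∃ λ e → emap ν e ≡ f
  esurj f = let x , νx = ν-vsurj (ι Δ′ f) ; e , _ , νe = out-surj x f (sym νx) in e , νe

module _ {G : Set} (_∙_ : Op₂ G) (ε : G) (_⁻¹ : Op₁ G) {Δ : Graph} (γ : E Δ → G) where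

  isGood-factor : {Γ Δ′ : Graph} {μ : Hom Δ′ Δ} {φ : Hom Γ Δ} {ν : Hom Γ Δ′} →
                  IsCovering φ → IsGood _∙_ ε _⁻¹ γ φ → IsCovering μ →
                  (∀ y → ∃ λ x → vmap ν x ≡ y) → (μ ∘ʰ ν) ≗ʰ φ → IsGood _∙_ ε _⁻¹ γ μ
  isGood-factor {Γ} {μ = μ} {φ} {ν} φ-cov φ-good μ-cov ν-vsurj (μν-v , μν-e)
                p cyc vol q (μq , q-over) =
    begin
      end q             ≡⟨ lift-end-unique μ-cov (map (mapStep ν) (trail l)) (steps q)
                             (IsWalk-map ν _ (isWalk l)) (valid q) νw ν-image-over ⟨
      vmap ν (finish l) ≡⟨ cong (vmap ν) l-cyclic ⟩
      vmap ν w          ≡⟨ νw ⟩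
      start q           ∎
    where
    open ≡-Reasoning
    w : V Γ
    w = proj₁ (ν-vsurj (start q))

    νw : vmap ν w ≡ start q
    νw = proj₂ (ν-vsurj (start q))

    φw : vmap φ w ≡ start p
    φw = trans (sym (μν-v w)) (trans (cong (vmap μ) νw) μq)

    l : Lift φ w (steps p)
    l = lift φ-cov (steps p) (valid p) φw

    l-cyclic : finish l ≡ w
    l-cyclic = φ-good p cyc vol
      (record { start = w ; steps = trail l ; end = finish l ; valid = isWalk l }) (φw , over l)

    ν-image-over : map (mapStep μ) (map (mapStep ν) (trail l)) ≡ map (mapStep μ) (steps q)
    ν-image-over = begin
      map (mapStep μ) (map (mapStep ν) (trail l)) ≡⟨ map-∘ (trail l) ⟨
      map (mapStep (μ ∘ʰ ν)) (trail l)            ≡⟨ map-cong μν-step (trail l) ⟩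
      map (mapStep φ) (trail l)                   ≡⟨ over l ⟩
      steps p                                     ≡⟨ q-over ⟨
      map (mapStep μ) (steps q)                   ∎
      where
      μν-step : mapStep (μ ∘ʰ ν) ≗ mapStep φ
      μν-step (e , d) = cong (_, d) (μν-e e)

  good-lifts-end-together :
    {Δ′ : Graph} {μ : Hom Δ′ Δ} → IsCovering μ → IsGood _∙_ ε _⁻¹ γ μ →
    ∀ {x y u u₁ u₂} ss ts qs rs → IsWalk Δ x ss y → IsWalk Δ x ts y →
    voltage _∙_ ε _⁻¹ {Δ} γ (ss ++ reverseWalk Δ ts) ≡ ε → vmap μ u ≡ x →
    IsWalk Δ′ u qs u₁ → map (mapStep μ) qs ≡ ss →
    IsWalk Δ′ u rs u₂ → map (mapStep μ) rs ≡ ts → u₁ ≡ u₂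
  good-lifts-end-together {Δ′} {μ} μ-cov μ-good {x} {u = u}
                          ss ts qs rs ws wt vol μu wq q-over wr r-over =
    lift-start-unique μ-cov (trail back) (reverseWalk Δ′ rs)
      (isWalk back) (IsWalk-reverse Δ′ rs wr) back-closes
      (trans (over back) (sym (trans (map-reverseWalk μ rs) (cong (reverseWalk Δ) r-over))))
    where
    back : Lift μ _ (reverseWalk Δ ts)
    back = lift μ-cov (reverseWalk Δ ts) (IsWalk-reverse Δ ts wt)
             (image-end μ qs ss wq μu q-over ws)

    back-closes : finish back ≡ u
    back-closes = μ-good
      (record { start = x ; steps = ss ++ reverseWalk Δ ts ; end = x
              ; valid = IsWalk-++ Δ ss _ ws (IsWalk-reverse Δ ts wt) })
      refl vol
      (record { start = u ; steps = qs ++ trail back ; end = finish back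
              ; valid = IsWalk-++ Δ′ qs _ wq (isWalk back) })
      (μu , trans (map-++ (mapStep μ) qs (trail back)) (cong₂ _++_ q-over (over back)))

module DerivedGraph {G : Set} {_∙_ : Op₂ G} {ε : G} {_⁻¹ : Op₁ G}
                    (isGroup : IsGroup _≡_ _∙_ ε _⁻¹) {Δ : Graph} (γ : E Δ → G) where

  open IsGroup isGroup using (assoc; identityʳ)

  private
    group : Group _ _
    group = record { isGroup = isGroup }

  open GroupProperties group
    using (∙-cancelʳ; //-rightDividesˡ; //-rightDividesʳ; identityʳ-unique)

  Γ : Graph
  Γ = Derived Δ _∙_ γ

  φ : Hom Γ Δ
  φ = canon Δ _∙_ γ

  volt : List (Step Δ) → G
  volt = voltage _∙_ ε _⁻¹ {Δ} γ

  walk-voltage : ∀ {a b} ss → IsWalk Γ a ss b → proj₂ a ∙ volt (map (mapStep φ) ss) ≡ proj₂ b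
  walk-voltage []                     refl        = identityʳ _
  walk-voltage (((f , g) , fwd) ∷ ss) (refl , ws) =
    trans (sym (assoc g (γ f) _)) (walk-voltage ss ws)
  walk-voltage (((f , g) , bwd) ∷ ss) (refl , ws) =
    trans (sym (assoc (g ∙ γ f) (γ f ⁻¹) _))
      (trans (cong (_∙ _) (//-rightDividesʳ (γ f) g)) (walk-voltage ss ws))

  closed-walk-voltage : ∀ {a} ss → IsWalk Γ a ss a → volt (map (mapStep φ) ss) ≡ ε
  closed-walk-voltage ss ws = identityʳ-unique _ _ (walk-voltage ss ws)

  canon-isCovering : IsCovering φ
  canon-isCovering = record
    { vsurj    = λ x → (x , ε) , refl
    ; esurj    = λ f → (f , ε) , refl
    ; in-inj   = λ { _ (f , g) (_ , g′) τe τe′ refl →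
                     cong (f ,_) (∙-cancelʳ (γ f) g g′ (cong proj₂ (trans τe (sym τe′)))) }
    ; in-surj  = λ v f τf → (f , proj₂ v ∙ (γ f ⁻¹))
                           , cong₂ _,_ τf (//-rightDividesˡ (γ f) (proj₂ v)) , refl
    ; out-inj  = λ { _ (f , _) (_ , _) ιe ιe′ refl →
                     cong (f ,_) (cong proj₂ (trans ιe (sym ιe′))) }
    ; out-surj = λ v f ιf → (f , proj₂ v) , cong (_, proj₂ v) ιf , refl
    }

  canon-isGood : IsGood _∙_ ε _⁻¹ γ φ
  canon-isGood p cyc vol q (φq , q-over) = cong₂ _,_ same-vertex same-element
    where
    open ≡-Reasoning
    same-vertex : proj₁ (end q) ≡ proj₁ (start q)
    same-vertex =
      trans (image-end φ (steps q) (steps p) (valid q) φq q-over (valid p)) (trans cyc (sym φq))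

    same-element : proj₂ (end q) ≡ proj₂ (start q)
    same-element = begin
      proj₂ (end q)                                      ≡⟨ walk-voltage (steps q) (valid q) ⟨
      proj₂ (start q) ∙ volt (map (mapStep φ) (steps q)) ≡⟨ cong (_ ∙_ ∘ volt) q-over ⟩
      proj₂ (start q) ∙ volt (steps p)                   ≡⟨ cong (_ ∙_) vol ⟩
      proj₂ (start q) ∙ ε                                ≡⟨ identityʳ _ ⟩
      proj₂ (start q)                                    ∎

module GoodCoverCriterion
  (Δ : Graph) (G : Set) (_∙_ : Op₂ G) (ε : G) (_⁻¹ : Op₁ G) (isGroup : IsGroup _≡_ _∙_ ε _⁻¹)
  (γ : E Δ → G) (Γ-conn : Connected (Derived Δ _∙_ γ)) (v₀ : V (Derived Δ _∙_ γ))
  (Δtop : Graph) (μ : Hom Δtop Δ) (μ-cov : IsCovering μ) (Δtop-conn : Connected Δtop)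
  (vtop : V Δtop) (μvtop : vmap μ vtop ≡ proj₁ v₀) where

  open DerivedGraph isGroup {Δ} γ

  followsRule⇒commutes : (ν : Hom Γ Δtop) → FollowsRule φ μ v₀ vtop ν → (μ ∘ʰ ν) ≗ʰ φ
  followsRule⇒commutes ν (ends , edges) = vmap-agree (μ ∘ʰ ν) φ μν-e Γ-conn v₀ μν-v₀ , μν-e
    where
    μν-e : emap (μ ∘ʰ ν) ≗ emap φ
    μν-e e = proj₁ (edges e)

    ν-v₀ : vmap ν v₀ ≡ vtop
    ν-v₀ = ends (record { start = v₀ ; steps = [] ; end = v₀ ; valid = refl }) refl
                (record { start = vtop ; steps = [] ; end = vtop ; valid = refl }) refl
                (μvtop , refl)

    μν-v₀ : vmap μ (vmap ν v₀) ≡ proj₁ v₀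
    μν-v₀ = trans (cong (vmap μ) ν-v₀) μvtop

  covering⇒good : (Σ (Hom Γ Δtop) λ ν → IsCovering ν × FollowsRule φ μ v₀ vtop ν) →
                  IsGood _∙_ ε _⁻¹ γ μ
  covering⇒good (ν , ν-cov , rule) =
    isGood-factor _∙_ ε _⁻¹ γ {ν = ν} canon-isCovering canon-isGood μ-cov
      (IsCovering.vsurj ν-cov) (followsRule⇒commutes ν rule)

  module Construction (μ-good : IsGood _∙_ ε _⁻¹ γ μ) where

    φ-lifts-end-together :
      ∀ {a b u u₁ u₂} ts ts′ qs rs → IsWalk Γ a ts b → IsWalk Γ a ts′ b → vmap μ u ≡ proj₁ a →
      IsWalk Δtop u qs u₁ → map (mapStep μ) qs ≡ map (mapStep φ) ts →
      IsWalk Δtop u rs u₂ → map (mapStep μ) rs ≡ map (mapStep φ) ts′ → u₁ ≡ u₂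
    φ-lifts-end-together ts ts′ qs rs wt wt′ =
      good-lifts-end-together _∙_ ε _⁻¹ γ μ-cov μ-good
        (map (mapStep φ) ts) (map (mapStep φ) ts′) qs rs
        (IsWalk-map φ ts wt) (IsWalk-map φ ts′ wt′) trivial-voltage
      where
      open ≡-Reasoning
      trivial-voltage : volt (map (mapStep φ) ts ++ reverseWalk Δ (map (mapStep φ) ts′)) ≡ ε
      trivial-voltage = begin
        volt (map (mapStep φ) ts ++ reverseWalk Δ (map (mapStep φ) ts′))
          ≡⟨ cong (λ ss → volt (map (mapStep φ) ts ++ ss)) (map-reverseWalk φ ts′) ⟨
        volt (map (mapStep φ) ts ++ map (mapStep φ) (reverseWalk Γ ts′))
          ≡⟨ cong volt (map-++ (mapStep φ) ts (reverseWalk Γ ts′)) ⟨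
        volt (map (mapStep φ) (ts ++ reverseWalk Γ ts′))
          ≡⟨ closed-walk-voltage _ (IsWalk-++ Γ ts _ wt (IsWalk-reverse Γ ts′ wt′)) ⟩
        ε ∎

    reach : ∀ w → ∃ λ ts → IsWalk Γ v₀ ts w
    reach = walkBetween Γ Γ-conn v₀

    liftReach : ∀ w → Lift μ vtop (map (mapStep φ) (proj₁ (reach w)))
    liftReach w = lift μ-cov _ (IsWalk-map φ _ (proj₂ (reach w))) μvtop

    νV : V Γ → V Δtop
    νV w = finish (liftReach w)

    νV-end : ∀ {w u} ts qs → IsWalk Γ v₀ ts w → IsWalk Δtop vtop qs u →
             map (mapStep μ) qs ≡ map (mapStep φ) ts → νV w ≡ u
    νV-end {w} ts qs wt wq q-over =
      φ-lifts-end-together (proj₁ (reach w)) ts (trail l) qs (proj₂ (reach w)) wt μvtop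
        (isWalk l) (over l) wq q-over
      where
      l : Lift μ vtop (map (mapStep φ) (proj₁ (reach w)))
      l = liftReach w

    μνV : ∀ w → vmap μ (νV w) ≡ proj₁ w
    μνV w = image-end μ (trail l) _ (isWalk l) μvtop (over l)
              (IsWalk-map φ _ (proj₂ (reach w)))
      where
      l : Lift μ vtop (map (mapStep φ) (proj₁ (reach w)))
      l = liftReach w

    outEdge : ∀ e → ∃ λ f → ι Δtop f ≡ νV (ι Γ e) × emap μ f ≡ proj₁ e
    outEdge e = IsCovering.out-surj μ-cov (νV (ι Γ e)) (proj₁ e) (sym (μνV (ι Γ e)))

    νE : E Γ → E Δtop
    νE e = proj₁ (outEdge e)

    νE-ι : ∀ e → ι Δtop (νE e) ≡ νV (ι Γ e)
    νE-ι e = proj₁ (proj₂ (outEdge e))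

    μνE : ∀ e → emap μ (νE e) ≡ proj₁ e
    μνE e = proj₂ (proj₂ (outEdge e))

    νE-τ : ∀ e → τ Δtop (νE e) ≡ νV (τ Γ e)
    νE-τ e = sym (νV-end (ts ++ (e , fwd) ∷ []) (trail l ++ (νE e , fwd) ∷ [])
                   (IsWalk-++ Γ ts _ wt (refl , refl))
                   (IsWalk-++ Δtop (trail l) _ (isWalk l) (νE-ι e , refl))
                   extended-over)
      where
      open ≡-Reasoning
      ts : List (Step Γ)
      ts = proj₁ (reach (ι Γ e))

      wt : IsWalk Γ v₀ ts (ι Γ e)
      wt = proj₂ (reach (ι Γ e))

      l : Lift μ vtop (map (mapStep φ) ts)
      l = liftReach (ι Γ e)

      extended-over : map (mapStep μ) (trail l ++ (νE e , fwd) ∷ []) ≡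
                      map (mapStep φ) (ts ++ (e , fwd) ∷ [])
      extended-over = begin
        map (mapStep μ) (trail l ++ (νE e , fwd) ∷ [])   ≡⟨ map-++ (mapStep μ) (trail l) _ ⟩
        map (mapStep μ) (trail l) ++ (emap μ (νE e) , fwd) ∷ []
          ≡⟨ cong₂ (λ ss f → ss ++ (f , fwd) ∷ []) (over l) (μνE e) ⟩
        map (mapStep φ) ts ++ (proj₁ e , fwd) ∷ []         ≡⟨ map-++ (mapStep φ) ts _ ⟨
        map (mapStep φ) (ts ++ (e , fwd) ∷ [])             ∎

    ν : Hom Γ Δtop
    ν = record { vmap = νV ; emap = νE ; ι-comm = νE-ι ; τ-comm = νE-τ }

    ν-vsurj : ∀ y → ∃ λ w → νV w ≡ y
    ν-vsurj y = finish l , νV-end (trail l) rs (isWalk l) wr (sym (over l))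
      where
      rs : List (Step Δtop)
      rs = proj₁ (walkBetween Δtop Δtop-conn vtop y)

      wr : IsWalk Δtop vtop rs y
      wr = proj₂ (walkBetween Δtop Δtop-conn vtop y)

      l : Lift φ v₀ (map (mapStep μ) rs)
      l = lift canon-isCovering (map (mapStep μ) rs) (IsWalk-map μ rs wr) (sym μvtop)

    ν-isCovering : IsCovering ν
    ν-isCovering = isCovering-factor {ν = ν} μ-cov canon-isCovering ν-vsurj (μνV , μνE)

    ν-followsRule : FollowsRule φ μ v₀ vtop ν
    ν-followsRule = ends , λ e → μνE e , νE-ι e
      where
      ends : ∀ (p : Walk Γ) → start p ≡ v₀ → ∀ (q : Walk Δtop) → start q ≡ vtop →
             IsLiftOf μ q (vmap φ (start p)) (map (mapStep φ) (steps p)) → νV (end p) ≡ end q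
      ends p refl q refl (_ , q-over) = νV-end (steps p) (steps q) (valid p) (valid q) q-over

  good⇒covering : IsGood _∙_ ε _⁻¹ γ μ →
                  Σ (Hom Γ Δtop) λ ν → IsCovering ν × FollowsRule φ μ v₀ vtop ν
  good⇒covering μ-good = ν , ν-isCovering , ν-followsRule
    where open Construction μ-good

proposition4p12 :
    (Δ : Graph) (G : Set) (_∙_ : Op₂ G) (ε : G) (_⁻¹ : Op₁ G) →
    IsGroup _≡_ _∙_ ε _⁻¹ →
    (γ : E Δ → G) →
    Connected (Derived Δ _∙_ γ) →
    (v₀ : V (Derived Δ _∙_ γ)) →
    (Δtop : Graph) (μ : Hom Δtop Δ) → IsCovering μ → Connected Δtop →
    (vtop : V Δtop) → vmap μ vtop ≡ proj₁ v₀ →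
    (Σ (Hom (Derived Δ _∙_ γ) Δtop) λ ν →
        IsCovering ν × FollowsRule (canon Δ _∙_ γ) μ v₀ vtop ν)
      ⇔ IsGood _∙_ ε _⁻¹ γ μ
proposition4p12 Δ G _∙_ ε _⁻¹ isGroup γ Γ-conn v₀ Δtop μ μ-cov Δtop-conn vtop μvtop =
  mk⇔ covering⇒good good⇒covering
  where
  open GoodCoverCriterion Δ G _∙_ ε _⁻¹ isGroup γ Γ-conn v₀ Δtop μ μ-cov Δtop-conn vtop μvtop
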